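{- Let $q\in\mathbb{C}$ be such that $[n]_q\neq 0$ for all $n\geq 1$, let $u\in\mathbb{C}\setminus\{0\}$, $\alpha,a\in\mathbb{C}$, let $(a_n^{(\alpha)})_{n\ge0}$ be complex numbers with $a_0^{(\alpha)}\neq0$, $(\mathcal{A}_q(t))^{\alpha}=\sum_{n\ge0}a_n^{(\alpha)}\frac{t^n}{[n]_q!}$, and define $\mathrm{P}_{n,q}^{(\alpha)}(x,y;u)$ by $(\mathcal{A}_q(t))^{\alpha}\mathrm{e}_q(tx)\mathrm{e}_q(ty,u)=\sum_{n\ge0}\mathrm{P}_{n,q}^{(\alpha)}(x,y;u)\frac{t^n}{[n]_q!}$. Let $(\mathrm{A}_{n,q}(a;u))_{n\ge0}$ be the sequence determined by the recursion $$\sum_{k=0}^{n}\genfrac{[}{]}{0pt}{}{n}{k}_{q}u^{k(k-n)}a^k\mathrm{A}_{n-k,q}(a;u)=1\qquad(n\ge0).$$ Then for all $n\ge0$, $$\mathrm{P}_{n,q}^{(\alpha)}(x,y;u)=\sum_{k=0}^{n}\genfrac{[}{]}{0pt}{}{n}{k}_{q}u^{\binom{k}{2}}\mathrm{A}_{k,q}(a;u)y^k\mathrm{P}_{n-k,q}^{(\alpha)}(x,ay;u).$$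
   Context: $[n]_q=\frac{1-q^n}{1-q}$, $[n]_q!=[1]_q\cdots[n]_q$ ($[0]_q!=1$), $\genfrac{[}{]}{0pt}{}{n}{k}_{q}=\frac{[n]_q!}{[k]_q![n-k]_q!}$. $\mathrm{e}_q(z,u)=\sum_{n\ge0}u^{\binom{n}{2}}\frac{z^n}{[n]_q!}$, $\mathrm{e}_q(z)=\mathrm{e}_q(z,1)$. Identities are of formal power series in $t$. -}

module Defs where

open import Level using (Level)
open import Data.Nat as ℕ using (ℕ; zero; suc; _∸_)
open import Data.Nat.Combinatorics using (_C_)
open import Algebra.Bundles using (CommutativeRing)

module QDefs {c ℓ : Level} (R : CommutativeRing c ℓ) where
  open CommutativeRing R

  pow : Carrier → ℕ → Carrier
  pow x zero = 1#
  pow x (suc n) = x * pow x n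

  sumTo : ℕ → (ℕ → Carrier) → Carrier
  sumTo zero f = f 0
  sumTo (suc n) f = sumTo n f + f (suc n)

  -- [n]_q = 1 + q + ... + q^(n-1)  (= (1-q^n)/(1-q))
  qint : Carrier → ℕ → Carrier
  qint q zero = 0#
  qint q (suc n) = 1# + q * qint q n

  qfact : Carrier → ℕ → Carrier
  qfact q zero = 1#
  qfact q (suc n) = qfact q n * qint q (suc n)

  qbinom : Carrier → ℕ → ℕ → Carrier
  qbinom q zero zero = 1#
  qbinom q zero (suc k) = 0#
  qbinom q (suc n) zero = 1#
  qbinom q (suc n) (suc k) = qbinom q n k + pow q (suc k) * qbinom q n (suc k)

  -- P^{(α)}_{n,q}(x,y;u): coefficient of t^n/[n]_q! in
  -- (Σ aα_n t^n/[n]!) · e_q(tx) · e_q(ty,u)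
  -- = Σ_k [n,k]_q aα_{n-k} Σ_j [k,j]_q x^{k-j} u^{C(j,2)} y^j
  Pcoef : (q u : Carrier) (aα : ℕ → Carrier) (x y : Carrier) → ℕ → Carrier
  Pcoef q u aα x y n =
    sumTo n (λ k → qbinom q n k * (aα (n ∸ k) *
      sumTo k (λ j → qbinom q k j * (pow x (k ∸ j) * (pow u (j C 2) * pow y j)))))

-- Write f ⊛ g for the coefficients of the product of the q-exponential generating functions
-- Σₙ fₙ tⁿ/[n]_q! of f and g, and E y for the coefficients u^C(n,2) yⁿ of e_q(ty, u). Then
-- P(x, y) = (E y ⊛ xⁿ) ⊛ a⁽ᵅ⁾. Since u^C(i+j,2) = u^C(i,2) u^C(j,2) u^(ij), the recursion for A
-- says exactly that E (a y) ⊛ G = E y, where G k = u^C(k,2) A_k yᵏ. The product ⊛ is commutative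
-- and associative (by the two q-Pascal rules and the q-trinomial identity), hence
-- P(x, y) = ((G ⊛ E (a y)) ⊛ xⁿ) ⊛ a⁽ᵅ⁾ = G ⊛ P(x, a y).
module Submission where

open import Defs
open import Level using (Level)
open import Data.Nat using (ℕ; _≥_; _∸_; _*_)
open import Data.Nat.Combinatorics using (_C_)
open import Relation.Nullary using (¬_)
open import Algebra.Bundles using (CommutativeRing)

open import Data.Nat using (zero; suc; z≤n; s≤s)
import Data.Nat as ℕ
import Data.Nat.Properties as ℕ
open import Data.Nat.Combinatorics using (nC1≡n; nCk+nC[k+1]≡[n+1]C[k+1])
open import Data.Nat.Solver using (module +-*-Solver)
open import Relation.Binary.PropositionalEquality as ≡ using (_≡_)

[1+n]C2≡n+nC2 : ∀ n → suc n C 2 ≡ n ℕ.+ n C 2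
[1+n]C2≡n+nC2 n = ≡.trans (≡.sym (nCk+nC[k+1]≡[n+1]C[k+1] n 1)) (≡.cong (ℕ._+ n C 2) (nC1≡n n))

[m+n]C2≡mC2+nC2+m*n : ∀ m n → (m ℕ.+ n) C 2 ≡ m C 2 ℕ.+ n C 2 ℕ.+ m * n
[m+n]C2≡mC2+nC2+m*n zero    n = ≡.sym (ℕ.+-identityʳ (n C 2))
[m+n]C2≡mC2+nC2+m*n (suc m) n = begin
  suc (m ℕ.+ n) C 2                              ≡⟨ [1+n]C2≡n+nC2 (m ℕ.+ n) ⟩
  m ℕ.+ n ℕ.+ (m ℕ.+ n) C 2                      ≡⟨ ≡.cong (m ℕ.+ n ℕ.+_) ([m+n]C2≡mC2+nC2+m*n m n) ⟩
  m ℕ.+ n ℕ.+ (m C 2 ℕ.+ n C 2 ℕ.+ m * n)        ≡⟨ rearrange m n (m C 2) (n C 2) ⟩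
  (m ℕ.+ m C 2) ℕ.+ n C 2 ℕ.+ suc m * n          ≡⟨ ≡.cong (λ k → k ℕ.+ n C 2 ℕ.+ suc m * n) ([1+n]C2≡n+nC2 m) ⟨
  suc m C 2 ℕ.+ n C 2 ℕ.+ suc m * n              ∎
  where
  open ≡.≡-Reasoning
  open +-*-Solver
  rearrange : ∀ m n a b → m ℕ.+ n ℕ.+ (a ℕ.+ b ℕ.+ m * n) ≡ (m ℕ.+ a) ℕ.+ b ℕ.+ suc m * n
  rearrange = solve 4 (λ m n a b → m :+ n :+ (a :+ b :+ m :* n) := (m :+ a) :+ b :+ (con 1 :+ m) :* n) ≡.refl

module Ring {c ℓ : Level} (R : CommutativeRing c ℓ) where
  open CommutativeRing R renaming (_*_ to _·_)
  open QDefs R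
  open import Relation.Binary.Reasoning.Setoid setoid
  open import Algebra.Properties.Semiring.Exp semiring using (_^_; ^-homo-*)
  open import Algebra.Properties.CommutativeSemiring.Exp commutativeSemiring using (^-distrib-*)
  open import Algebra.Properties.CommutativeSemigroup +-commutativeSemigroup
    using () renaming (interchange to +-interchange)
  open import Algebra.Properties.CommutativeSemigroup *-commutativeSemigroup
    using () renaming (interchange to ·-interchange)
  open import Algebra.Solver.Ring.NaturalCoefficients.Default commutativeSemiring
    using (solve; _:+_; _:*_; _:=_)

  pow≡^ : ∀ x n → pow x n ≡ x ^ n
  pow≡^ x zero    = ≡.refl
  pow≡^ x (suc n) = ≡.cong (x ·_) (pow≡^ x n)

  pow-homo-+ : ∀ x m n → pow x (m ℕ.+ n) ≈ pow x m · pow x n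
  pow-homo-+ x m n rewrite pow≡^ x (m ℕ.+ n) | pow≡^ x m | pow≡^ x n = ^-homo-* x m n

  pow-distrib-· : ∀ x y n → pow (x · y) n ≈ pow x n · pow y n
  pow-distrib-· x y n rewrite pow≡^ (x · y) n | pow≡^ x n | pow≡^ y n = ^-distrib-* x y n

  pow-inverse : ∀ {u v} → u · v ≈ 1# → ∀ n → pow u n · pow v n ≈ 1#
  pow-inverse uv zero = *-identityʳ 1#
  pow-inverse {u} {v} uv (suc n) = begin
    u · pow u n · (v · pow v n)  ≈⟨ ·-interchange u (pow u n) v (pow v n) ⟩
    u · v · (pow u n · pow v n)  ≈⟨ *-cong uv (pow-inverse uv n) ⟩
    1# · 1#                      ≈⟨ *-identityˡ 1# ⟩
    1#                           ∎

  sumTo-cong : ∀ n {f g} → (∀ k → k ℕ.≤ n → f k ≈ g k) → sumTo n f ≈ sumTo n g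
  sumTo-cong zero    f≈g = f≈g 0 z≤n
  sumTo-cong (suc n) f≈g =
    +-cong (sumTo-cong n (λ k k≤n → f≈g k (ℕ.m≤n⇒m≤1+n k≤n))) (f≈g (suc n) ℕ.≤-refl)

  Σ-antidiag : ℕ → (ℕ → ℕ → Carrier) → Carrier
  Σ-antidiag zero    F = F 0 0
  Σ-antidiag (suc n) F = F 0 (suc n) + Σ-antidiag n (λ i j → F (suc i) j)

  Σ-antidiag-cong : ∀ n {F G} → (∀ i j → F i j ≈ G i j) → Σ-antidiag n F ≈ Σ-antidiag n G
  Σ-antidiag-cong zero    F≈G = F≈G 0 0
  Σ-antidiag-cong (suc n) F≈G = +-cong (F≈G 0 (suc n)) (Σ-antidiag-cong n (λ i → F≈G (suc i)))

  Σ-antidiag-distrib-+ : ∀ n F G →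
    Σ-antidiag n (λ i j → F i j + G i j) ≈ Σ-antidiag n F + Σ-antidiag n G
  Σ-antidiag-distrib-+ zero    F G = refl
  Σ-antidiag-distrib-+ (suc n) F G =
    trans (+-congˡ (Σ-antidiag-distrib-+ n _ _)) (+-interchange _ _ _ _)

  *-distribˡ-Σ-antidiag : ∀ n x F → x · Σ-antidiag n F ≈ Σ-antidiag n (λ i j → x · F i j)
  *-distribˡ-Σ-antidiag zero    x F = refl
  *-distribˡ-Σ-antidiag (suc n) x F = trans (distribˡ x _ _) (+-congˡ (*-distribˡ-Σ-antidiag n x _))

  *-distribʳ-Σ-antidiag : ∀ n x F → Σ-antidiag n F · x ≈ Σ-antidiag n (λ i j → F i j · x)
  *-distribʳ-Σ-antidiag zero    x F = refl
  *-distribʳ-Σ-antidiag (suc n) x F = trans (distribʳ x _ _) (+-congˡ (*-distribʳ-Σ-antidiag n x _))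

  Σ-antidiag-init-last : ∀ n F →
    Σ-antidiag (suc n) F ≈ Σ-antidiag n (λ i j → F i (suc j)) + F (suc n) 0
  Σ-antidiag-init-last zero    F = refl
  Σ-antidiag-init-last (suc n) F =
    trans (+-congˡ (Σ-antidiag-init-last n (λ i → F (suc i)))) (sym (+-assoc _ _ _))

  Σ-antidiag-swap : ∀ n F → Σ-antidiag n F ≈ Σ-antidiag n (λ i j → F j i)
  Σ-antidiag-swap zero    F = refl
  Σ-antidiag-swap (suc n) F =
    trans (+-congˡ (Σ-antidiag-swap n (λ i → F (suc i))))
          (trans (+-comm _ _) (sym (Σ-antidiag-init-last n (λ i j → F j i))))

  Σ-antidiag-on-i+j≡n : ∀ n (F : ℕ → ℕ → ℕ → Carrier) →
    Σ-antidiag n (λ i j → F (i ℕ.+ j) i j) ≈ Σ-antidiag n (F n)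
  Σ-antidiag-on-i+j≡n zero    F = refl
  Σ-antidiag-on-i+j≡n (suc n) F = +-congˡ (Σ-antidiag-on-i+j≡n n (λ m i → F (suc m) (suc i)))

  Σ-antidiag-assoc : ∀ n (F : ℕ → ℕ → ℕ → Carrier) →
    Σ-antidiag n (λ m k → Σ-antidiag m (λ i j → F i j k)) ≈
    Σ-antidiag n (λ i m → Σ-antidiag m (λ j k → F i j k))
  Σ-antidiag-assoc zero    F = refl
  Σ-antidiag-assoc (suc n) F = trans
    (+-congˡ (trans (Σ-antidiag-distrib-+ n _ _) (+-congˡ (Σ-antidiag-assoc n (λ i → F (suc i))))))
    (sym (+-assoc _ _ _))

  sumTo-as-Σ-antidiag : ∀ n H → sumTo n (λ k → H k (n ∸ k)) ≈ Σ-antidiag n H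
  sumTo-as-Σ-antidiag zero    H = refl
  sumTo-as-Σ-antidiag (suc n) H = begin
    sumTo n (λ k → H k (suc n ∸ k)) + H (suc n) (n ∸ n)
      ≈⟨ +-cong (sumTo-cong n (λ k k≤n → reflexive (≡.cong (H k) (ℕ.+-∸-assoc 1 k≤n))))
                (reflexive (≡.cong (H (suc n)) (ℕ.n∸n≡0 n))) ⟩
    sumTo n (λ k → H k (suc (n ∸ k))) + H (suc n) 0
      ≈⟨ +-congʳ (sumTo-as-Σ-antidiag n (λ i j → H i (suc j))) ⟩
    Σ-antidiag n (λ i j → H i (suc j)) + H (suc n) 0
      ≈⟨ Σ-antidiag-init-last n H ⟨
    Σ-antidiag (suc n) H
      ∎

  -- the coefficients of e_q(ty, u) = Σₙ u^C(n,2) yⁿ tⁿ/[n]_q!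
  expCoeff : (u y : Carrier) → ℕ → Carrier
  expCoeff u y n = pow u (n C 2) · pow y n

  expCoeff-+ : ∀ u y i j → expCoeff u y (i ℕ.+ j) ≈ pow u (i * j) · (expCoeff u y i · expCoeff u y j)
  expCoeff-+ u y i j = begin
    pow u ((i ℕ.+ j) C 2) · pow y (i ℕ.+ j)
      ≡⟨ ≡.cong (λ m → pow u m · pow y (i ℕ.+ j)) ([m+n]C2≡mC2+nC2+m*n i j) ⟩
    pow u (i C 2 ℕ.+ j C 2 ℕ.+ i * j) · pow y (i ℕ.+ j)
      ≈⟨ *-cong (trans (pow-homo-+ u (i C 2 ℕ.+ j C 2) (i * j)) (*-congʳ (pow-homo-+ u (i C 2) (j C 2))))
              (pow-homo-+ y i j) ⟩
    pow u (i C 2) · pow u (j C 2) · pow u (i * j) · (pow y i · pow y j)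
      ≈⟨ regroup _ _ _ _ _ ⟩
    pow u (i * j) · (expCoeff u y i · expCoeff u y j)
      ∎
    where
    regroup : ∀ uᵢ uⱼ w yᵢ yⱼ → uᵢ · uⱼ · w · (yᵢ · yⱼ) ≈ w · (uᵢ · yᵢ · (uⱼ · yⱼ))
    regroup = solve 5 (λ uᵢ uⱼ w yᵢ yⱼ → uᵢ :* uⱼ :* w :* (yᵢ :* yⱼ) := w :* (uᵢ :* yᵢ :* (uⱼ :* yⱼ))) refl

  module QExponential (q : Carrier) where

    qmultinom : ℕ → ℕ → Carrier
    qmultinom zero    j       = 1#
    qmultinom (suc i) zero    = 1#
    qmultinom (suc i) (suc j) = qmultinom i (suc j) + pow q (suc i) · qmultinom (suc i) j

    n<k⇒qbinom≈0 : ∀ {n k} → n ℕ.< k → qbinom q n k ≈ 0#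
    n<k⇒qbinom≈0 {zero}  {suc k} _ = refl
    n<k⇒qbinom≈0 {suc n} {suc k} (s≤s n<k) = begin
      qbinom q n k + pow q (suc k) · qbinom q n (suc k)
        ≈⟨ +-cong (n<k⇒qbinom≈0 n<k) (*-congˡ (n<k⇒qbinom≈0 (ℕ.m<n⇒m<1+n n<k))) ⟩
      0# + pow q (suc k) · 0#   ≈⟨ +-identityˡ _ ⟩
      pow q (suc k) · 0#        ≈⟨ zeroʳ _ ⟩
      0#                        ∎

    qbinom[n,n]≈1 : ∀ n → qbinom q n n ≈ 1#
    qbinom[n,n]≈1 zero    = refl
    qbinom[n,n]≈1 (suc n) = begin
      qbinom q n n + pow q (suc n) · qbinom q n (suc n)
        ≈⟨ +-cong (qbinom[n,n]≈1 n) (*-congˡ (n<k⇒qbinom≈0 (ℕ.n<1+n n))) ⟩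
      1# + pow q (suc n) · 0#   ≈⟨ +-congˡ (zeroʳ _) ⟩
      1# + 0#                   ≈⟨ +-identityʳ 1# ⟩
      1#                        ∎

    qbinom[n,0]≈1 : ∀ n → qbinom q n 0 ≈ 1#
    qbinom[n,0]≈1 zero    = refl
    qbinom[n,0]≈1 (suc n) = refl

    qbinom[i+j,i]≈qmultinom : ∀ i j → qbinom q (i ℕ.+ j) i ≈ qmultinom i j
    qbinom[i+j,i]≈qmultinom zero    j       = qbinom[n,0]≈1 j
    qbinom[i+j,i]≈qmultinom (suc i) zero    =
      trans (reflexive (≡.cong (λ m → qbinom q m (suc i)) (ℕ.+-identityʳ (suc i))))
            (qbinom[n,n]≈1 (suc i))
    qbinom[i+j,i]≈qmultinom (suc i) (suc j) = +-cong (qbinom[i+j,i]≈qmultinom i (suc j))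
      (*-congˡ (trans (reflexive (≡.cong (λ m → qbinom q m (suc i)) (ℕ.+-suc i j)))
                      (qbinom[i+j,i]≈qmultinom (suc i) j)))

    qint[1+n]≈qint[n]+qⁿ : ∀ n → qint q (suc n) ≈ qint q n + pow q n
    qint[1+n]≈qint[n]+qⁿ zero    = trans (+-congˡ (zeroʳ q)) (trans (+-identityʳ 1#) (sym (+-identityˡ 1#)))
    qint[1+n]≈qint[n]+qⁿ (suc n) = begin
      1# + q · qint q (suc n)             ≈⟨ +-congˡ (*-congˡ (qint[1+n]≈qint[n]+qⁿ n)) ⟩
      1# + q · (qint q n + pow q n)       ≈⟨ +-congˡ (distribˡ q _ _) ⟩
      1# + (q · qint q n + pow q (suc n)) ≈⟨ +-assoc _ _ _ ⟨
      qint q (suc n) + pow q (suc n)      ∎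

    qint1≈1 : qint q 1 ≈ 1#
    qint1≈1 = trans (+-congˡ (zeroʳ q)) (+-identityʳ 1#)

    qmultinom[1,j]≈qint[1+j] : ∀ j → qmultinom 1 j ≈ qint q (suc j)
    qmultinom[1,j]≈qint[1+j] zero    = sym qint1≈1
    qmultinom[1,j]≈qint[1+j] (suc j) = +-congˡ (*-cong (*-identityʳ q) (qmultinom[1,j]≈qint[1+j] j))

    qmultinom[i,1]≈qint[1+i] : ∀ i → qmultinom i 1 ≈ qint q (suc i)
    qmultinom[i,1]≈qint[1+i] zero    = sym qint1≈1
    qmultinom[i,1]≈qint[1+i] (suc i) =
      trans (+-cong (qmultinom[i,1]≈qint[1+i] i) (*-identityʳ _)) (sym (qint[1+n]≈qint[n]+qⁿ (suc i)))

    qmultinom-pascalʳ : ∀ i j →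
      qmultinom (suc i) (suc j) ≈ qmultinom (suc i) j + pow q (suc j) · qmultinom i (suc j)
    qmultinom-pascalʳ zero j = begin
      qmultinom 1 (suc j)                       ≈⟨ qmultinom[1,j]≈qint[1+j] (suc j) ⟩
      qint q (suc (suc j))                      ≈⟨ qint[1+n]≈qint[n]+qⁿ (suc j) ⟩
      qint q (suc j) + pow q (suc j)            ≈⟨ +-cong (qmultinom[1,j]≈qint[1+j] j) (*-identityʳ _) ⟨
      qmultinom 1 j + pow q (suc j) · 1#        ∎
    qmultinom-pascalʳ (suc i) zero = begin
      qmultinom (suc (suc i)) 1                 ≈⟨ qmultinom[i,1]≈qint[1+i] (suc (suc i)) ⟩
      1# + q · qint q (suc (suc i))
        ≈⟨ +-congˡ (*-cong (*-identityʳ q) (qmultinom[i,1]≈qint[1+i] (suc i))) ⟨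
      1# + pow q 1 · qmultinom (suc i) 1        ∎
    qmultinom-pascalʳ (suc i) (suc j) =
      trans (+-cong (qmultinom-pascalʳ i (suc j)) (*-congˡ (qmultinom-pascalʳ (suc i) j)))
            (exchange _ _ _ q (pow q (suc i)) (pow q (suc j)))
      where
      exchange : ∀ a b d p r s → (a + p · s · b) + p · r · (d + s · a) ≈ (a + p · r · d) + p · s · (b + r · a)
      exchange = solve 6 (λ a b d p r s → (a :+ p :* s :* b) :+ p :* r :* (d :+ s :* a)
                                       := (a :+ p :* r :* d) :+ p :* s :* (b :+ r :* a)) refl

    qmultinom-comm : ∀ i j → qmultinom i j ≈ qmultinom j i
    qmultinom-comm zero    zero    = refl
    qmultinom-comm zero    (suc j) = refl
    qmultinom-comm (suc i) zero    = refl
    qmultinom-comm (suc i) (suc j) =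
      trans (+-cong (qmultinom-comm i (suc j)) (*-congˡ (qmultinom-comm (suc i) j)))
            (sym (qmultinom-pascalʳ j i))

    -- Both sides are the q-trinomial coefficient [i+j+k; i, j, k]_q.
    qmultinom-assoc : ∀ i j k →
      qmultinom (i ℕ.+ j) k · qmultinom i j ≈ qmultinom i (j ℕ.+ k) · qmultinom j k
    qmultinom-assoc zero j k = trans (*-identityʳ _) (sym (*-identityˡ _))
    qmultinom-assoc (suc i) zero k = begin
      qmultinom (suc i ℕ.+ 0) k · 1#  ≈⟨ *-identityʳ _ ⟩
      qmultinom (suc i ℕ.+ 0) k       ≡⟨ ≡.cong (λ m → qmultinom m k) (ℕ.+-identityʳ (suc i)) ⟩
      qmultinom (suc i) k             ≈⟨ *-identityʳ _ ⟨
      qmultinom (suc i) k · 1#        ∎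
    qmultinom-assoc (suc i) (suc j) zero = begin
      1# · qmultinom (suc i) (suc j)           ≈⟨ *-identityˡ _ ⟩
      qmultinom (suc i) (suc j)                ≡⟨ ≡.cong (qmultinom (suc i)) (ℕ.+-identityʳ (suc j)) ⟨
      qmultinom (suc i) (suc j ℕ.+ 0)          ≈⟨ *-identityʳ _ ⟨
      qmultinom (suc i) (suc j ℕ.+ 0) · 1#     ∎
    qmultinom-assoc (suc i) (suc j) (suc k) = begin
      qmultinom (suc i ℕ.+ suc j) (suc k) · qmultinom (suc i) (suc j)
        ≈⟨ expandˡ _ _ _ _ (pow q (suc i ℕ.+ suc j)) r ⟩
      qmultinom (i ℕ.+ suc j) (suc k) · qmultinom i (suc j)
        + r · (qmultinom (i ℕ.+ suc j) (suc k) · qmultinom (suc i) j)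
        + pow q (suc i ℕ.+ suc j) · (qmultinom (suc i ℕ.+ suc j) k · qmultinom (suc i) (suc j))
        ≈⟨ +-cong (+-cong (qmultinom-assoc i (suc j) (suc k)) (*-congˡ middle))
                  (*-cong (pow-homo-+ q (suc i) (suc j)) last) ⟩
      qmultinom i (suc j ℕ.+ suc k) · qmultinom (suc j) (suc k)
        + r · (qmultinom (suc i) (j ℕ.+ suc k) · qmultinom j (suc k))
        + r · s · (qmultinom (suc i) (j ℕ.+ suc k) · qmultinom (suc j) k)
        ≈⟨ expandʳ _ _ _ _ r s ⟨
      qmultinom (suc i) (suc j ℕ.+ suc k) · qmultinom (suc j) (suc k)
        ∎
      where
      r s : Carrier
      r = pow q (suc i)
      s = pow q (suc j)
      middle : qmultinom (i ℕ.+ suc j) (suc k) · qmultinom (suc i) j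
             ≈ qmultinom (suc i) (j ℕ.+ suc k) · qmultinom j (suc k)
      middle = trans (*-congʳ (reflexive (≡.cong (λ m → qmultinom m (suc k)) (ℕ.+-suc i j))))
                     (qmultinom-assoc (suc i) j (suc k))
      last : qmultinom (suc i ℕ.+ suc j) k · qmultinom (suc i) (suc j)
           ≈ qmultinom (suc i) (j ℕ.+ suc k) · qmultinom (suc j) k
      last = trans (qmultinom-assoc (suc i) (suc j) k)
                   (*-congʳ (reflexive (≡.cong (qmultinom (suc i)) (≡.sym (ℕ.+-suc j k)))))
      expandˡ : ∀ a b d e p r → (a + p · b) · (d + r · e) ≈ a · d + r · (a · e) + p · (b · (d + r · e))
      expandˡ = solve 6 (λ a b d e p r → (a :+ p :* b) :* (d :+ r :* e)
                                      := a :* d :+ r :* (a :* e) :+ p :* (b :* (d :+ r :* e))) refl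
      expandʳ : ∀ a b d e r s → (a + r · b) · (d + s · e) ≈ a · (d + s · e) + r · (b · d) + r · s · (b · e)
      expandʳ = solve 6 (λ a b d e r s → (a :+ r :* b) :* (d :+ s :* e)
                                      := a :* (d :+ s :* e) :+ r :* (b :* d) :+ r :* s :* (b :* e)) refl

    sumTo-qbinom≈Σ-antidiag : ∀ n (W : ℕ → ℕ → Carrier) →
      sumTo n (λ k → qbinom q n k · W k (n ∸ k)) ≈ Σ-antidiag n (λ i j → qmultinom i j · W i j)
    sumTo-qbinom≈Σ-antidiag n W = trans (sumTo-cong n qbinom≈qmultinom)
                                       (sumTo-as-Σ-antidiag n (λ i j → qmultinom i j · W i j))
      where
      qbinom≈qmultinom : ∀ k → k ℕ.≤ n →
        qbinom q n k · W k (n ∸ k) ≈ qmultinom k (n ∸ k) · W k (n ∸ k)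
      qbinom≈qmultinom k k≤n = *-congʳ (trans
        (reflexive (≡.cong (λ m → qbinom q m k) (≡.sym (ℕ.m+[n∸m]≡n k≤n))))
        (qbinom[i+j,i]≈qmultinom k (n ∸ k)))

    infixl 7 _⊛_
    _⊛_ : (ℕ → Carrier) → (ℕ → Carrier) → ℕ → Carrier
    (f ⊛ g) n = Σ-antidiag n (λ i j → qmultinom i j · (f i · g j))

    ⊛-cong : ∀ {f f′ g g′} → (∀ i → f i ≈ f′ i) → (∀ j → g j ≈ g′ j) → ∀ n → (f ⊛ g) n ≈ (f′ ⊛ g′) n
    ⊛-cong f≈f′ g≈g′ n = Σ-antidiag-cong n (λ i j → *-congˡ (*-cong (f≈f′ i) (g≈g′ j)))

    ⊛-comm : ∀ f g n → (f ⊛ g) n ≈ (g ⊛ f) n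
    ⊛-comm f g n = trans (Σ-antidiag-swap n _)
      (Σ-antidiag-cong n (λ i j → *-cong (qmultinom-comm j i) (*-comm (f j) (g i))))

    ⊛-assoc : ∀ f g h n → ((f ⊛ g) ⊛ h) n ≈ (f ⊛ (g ⊛ h)) n
    ⊛-assoc f g h n = begin
      ((f ⊛ g) ⊛ h) n
        ≈⟨ Σ-antidiag-cong n expandˡ ⟩
      Σ-antidiag n (λ m k → Σ-antidiag m (λ i j → term (qmultinom (i ℕ.+ j) k · qmultinom i j) i j k))
        ≈⟨ Σ-antidiag-assoc n _ ⟩
      Σ-antidiag n (λ i m → Σ-antidiag m (λ j k → term (qmultinom (i ℕ.+ j) k · qmultinom i j) i j k))
        ≈⟨ Σ-antidiag-cong n (λ i m → Σ-antidiag-cong m (λ j k → *-congʳ (qmultinom-assoc i j k))) ⟩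
      Σ-antidiag n (λ i m → Σ-antidiag m (λ j k → term (qmultinom i (j ℕ.+ k) · qmultinom j k) i j k))
        ≈⟨ Σ-antidiag-cong n expandʳ ⟨
      (f ⊛ (g ⊛ h)) n
        ∎
      where
      term : Carrier → ℕ → ℕ → ℕ → Carrier
      term b i j k = b · (f i · g j · h k)

      expandˡ : ∀ m k → qmultinom m k · ((f ⊛ g) m · h k)
              ≈ Σ-antidiag m (λ i j → term (qmultinom (i ℕ.+ j) k · qmultinom i j) i j k)
      expandˡ m k = begin
        qmultinom m k · ((f ⊛ g) m · h k)
          ≈⟨ *-congˡ (*-distribʳ-Σ-antidiag m (h k) _) ⟩
        qmultinom m k · Σ-antidiag m (λ i j → qmultinom i j · (f i · g j) · h k)
          ≈⟨ *-distribˡ-Σ-antidiag m _ _ ⟩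
        Σ-antidiag m (λ i j → qmultinom m k · (qmultinom i j · (f i · g j) · h k))
          ≈⟨ Σ-antidiag-cong m (λ i j → regroup _ _ (f i) (g j) (h k)) ⟩
        Σ-antidiag m (λ i j → term (qmultinom m k · qmultinom i j) i j k)
          ≈⟨ Σ-antidiag-on-i+j≡n m (λ m′ i j → term (qmultinom m′ k · qmultinom i j) i j k) ⟨
        Σ-antidiag m (λ i j → term (qmultinom (i ℕ.+ j) k · qmultinom i j) i j k)
          ∎
        where
        regroup : ∀ b b′ x y z → b · (b′ · (x · y) · z) ≈ b · b′ · (x · y · z)
        regroup = solve 5 (λ b b′ x y z → b :* (b′ :* (x :* y) :* z) := b :* b′ :* (x :* y :* z)) refl

      expandʳ : ∀ i m → qmultinom i m · (f i · (g ⊛ h) m)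
              ≈ Σ-antidiag m (λ j k → term (qmultinom i (j ℕ.+ k) · qmultinom j k) i j k)
      expandʳ i m = begin
        qmultinom i m · (f i · (g ⊛ h) m)
          ≈⟨ *-congˡ (*-distribˡ-Σ-antidiag m (f i) _) ⟩
        qmultinom i m · Σ-antidiag m (λ j k → f i · (qmultinom j k · (g j · h k)))
          ≈⟨ *-distribˡ-Σ-antidiag m _ _ ⟩
        Σ-antidiag m (λ j k → qmultinom i m · (f i · (qmultinom j k · (g j · h k))))
          ≈⟨ Σ-antidiag-cong m (λ j k → regroup _ _ (f i) (g j) (h k)) ⟩
        Σ-antidiag m (λ j k → term (qmultinom i m · qmultinom j k) i j k)
          ≈⟨ Σ-antidiag-on-i+j≡n m (λ m′ j k → term (qmultinom i m′ · qmultinom j k) i j k) ⟨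
        Σ-antidiag m (λ j k → term (qmultinom i (j ℕ.+ k) · qmultinom j k) i j k)
          ∎
        where
        regroup : ∀ b b′ x y z → b · (x · (b′ · (y · z))) ≈ b · b′ · (x · y · z)
        regroup = solve 5 (λ b b′ x y z → b :* (x :* (b′ :* (y :* z))) := b :* b′ :* (x :* y :* z)) refl

    Pcoef-as-⊛ : ∀ u aα x y n → Pcoef q u aα x y n ≈ ((expCoeff u y ⊛ pow x) ⊛ aα) n
    Pcoef-as-⊛ u aα x y n = begin
      Pcoef q u aα x y n
        ≈⟨ sumTo-cong n (λ k _ → *-congˡ (*-congˡ (inner k))) ⟩
      sumTo n (λ k → qbinom q n k · (aα (n ∸ k) · (expCoeff u y ⊛ pow x) k))
        ≈⟨ sumTo-qbinom≈Σ-antidiag n _ ⟩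
      Σ-antidiag n (λ k l → qmultinom k l · (aα l · (expCoeff u y ⊛ pow x) k))
        ≈⟨ Σ-antidiag-cong n (λ k l → *-congˡ (*-comm _ _)) ⟩
      ((expCoeff u y ⊛ pow x) ⊛ aα) n
        ∎
      where
      inner : ∀ k → sumTo k (λ j → qbinom q k j · (pow x (k ∸ j) · expCoeff u y j)) ≈ (expCoeff u y ⊛ pow x) k
      inner k = trans (sumTo-qbinom≈Σ-antidiag k _) (Σ-antidiag-cong k (λ j l → *-congˡ (*-comm _ _)))

    expCoeff-factorisation : ∀ {u u⁻¹} → u · u⁻¹ ≈ 1# → ∀ a y (A : ℕ → Carrier) →
      (∀ n → sumTo n (λ k → qbinom q n k · (pow u⁻¹ (k * (n ∸ k)) · (pow a k · A (n ∸ k)))) ≈ 1#) →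
      ∀ n → (expCoeff u (a · y) ⊛ (λ k → pow u (k C 2) · (A k · pow y k))) n ≈ expCoeff u y n
    expCoeff-factorisation {u} {u⁻¹} uu⁻¹ a y A recursion n = begin
      (expCoeff u (a · y) ⊛ G) n
        ≈⟨ Σ-antidiag-cong n pull-out ⟩
      Σ-antidiag n (λ i j → expCoeff u y (i ℕ.+ j) · (qmultinom i j · W i j))
        ≈⟨ Σ-antidiag-on-i+j≡n n (λ m i j → expCoeff u y m · (qmultinom i j · W i j)) ⟩
      Σ-antidiag n (λ i j → expCoeff u y n · (qmultinom i j · W i j))
        ≈⟨ *-distribˡ-Σ-antidiag n _ _ ⟨
      expCoeff u y n · Σ-antidiag n (λ i j → qmultinom i j · W i j)
        ≈⟨ *-congˡ (trans (sym (sumTo-qbinom≈Σ-antidiag n W)) (recursion n)) ⟩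
      expCoeff u y n · 1#
        ≈⟨ *-identityʳ _ ⟩
      expCoeff u y n
        ∎
      where
      G : ℕ → Carrier
      G k = pow u (k C 2) · (A k · pow y k)
      W : ℕ → ℕ → Carrier
      W i j = pow u⁻¹ (i * j) · (pow a i · A j)
      pull-out : ∀ i j → qmultinom i j · (expCoeff u (a · y) i · G j)
                       ≈ expCoeff u y (i ℕ.+ j) · (qmultinom i j · W i j)
      pull-out i j = begin
        qmultinom i j · (expCoeff u (a · y) i · G j)
          ≈⟨ *-congˡ (*-congʳ (*-congˡ (pow-distrib-· a y i))) ⟩
        qmultinom i j · (pow u (i C 2) · (pow a i · pow y i) · G j)
          ≈⟨ *-identityˡ _ ⟨
        1# · (qmultinom i j · (pow u (i C 2) · (pow a i · pow y i) · G j))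
          ≈⟨ *-congʳ (pow-inverse uu⁻¹ (i * j)) ⟨
        pow u (i * j) · pow u⁻¹ (i * j) · (qmultinom i j · (pow u (i C 2) · (pow a i · pow y i) · G j))
          ≈⟨ regroup _ _ _ _ _ _ _ _ _ ⟩
        pow u (i * j) · (expCoeff u y i · expCoeff u y j) · (qmultinom i j · W i j)
          ≈⟨ *-congʳ (expCoeff-+ u y i j) ⟨
        expCoeff u y (i ℕ.+ j) · (qmultinom i j · W i j)
          ∎
        where
        regroup : ∀ w v b uᵢ uⱼ aᵢ Aⱼ yᵢ yⱼ →
          w · v · (b · (uᵢ · (aᵢ · yᵢ) · (uⱼ · (Aⱼ · yⱼ))))
            ≈ w · (uᵢ · yᵢ · (uⱼ · yⱼ)) · (b · (v · (aᵢ · Aⱼ)))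
        regroup = solve 9 (λ w v b uᵢ uⱼ aᵢ Aⱼ yᵢ yⱼ →
          w :* v :* (b :* (uᵢ :* (aᵢ :* yᵢ) :* (uⱼ :* (Aⱼ :* yⱼ))))
            := w :* (uᵢ :* yᵢ :* (uⱼ :* yⱼ)) :* (b :* (v :* (aᵢ :* Aⱼ)))) refl

theorem8 : ∀ {c ℓ : Level} (R : CommutativeRing c ℓ) →
    let open CommutativeRing R renaming (_*_ to _·_) in
    let open QDefs R in
    (q u u⁻¹ a x y : Carrier) (aα : ℕ → Carrier) →
    (∀ n → n ≥ 1 → ¬ (qint q n ≈ 0#)) →
    u · u⁻¹ ≈ 1# →
    ¬ (aα 0 ≈ 0#) →
    (A : ℕ → Carrier) →
    (∀ n → sumTo n (λ k → qbinom q n k · (pow u⁻¹ (k * (n ∸ k)) · (pow a k · A (n ∸ k)))) ≈ 1#) →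
    ∀ n → Pcoef q u aα x y n
    ≈ sumTo n (λ k → qbinom q n k · (pow u (k C 2) · (A k · (pow y k · Pcoef q u aα x (a · y) (n ∸ k)))))
theorem8 R q u u⁻¹ a x y aα _ uu⁻¹ _ A recursion n = begin
  P y n                                   ≈⟨ Pcoef-as-⊛ u aα x y n ⟩
  ((E y ⊛ pow x) ⊛ aα) n                  ≈⟨ ⊛-cong (⊛-cong E-split (λ _ → refl)) (λ _ → refl) n ⟩
  (((G ⊛ E (a · y)) ⊛ pow x) ⊛ aα) n      ≈⟨ ⊛-cong (⊛-assoc G (E (a · y)) (pow x)) (λ _ → refl) n ⟩
  ((G ⊛ (E (a · y) ⊛ pow x)) ⊛ aα) n      ≈⟨ ⊛-assoc G (E (a · y) ⊛ pow x) aα n ⟩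
  (G ⊛ ((E (a · y) ⊛ pow x) ⊛ aα)) n      ≈⟨ ⊛-cong (λ _ → refl) (λ m → sym (Pcoef-as-⊛ u aα x (a · y) m)) n ⟩
  (G ⊛ P (a · y)) n                       ≈⟨ sumTo-qbinom≈Σ-antidiag n (λ k l → G k · P (a · y) l) ⟨
  sumTo n (λ k → qbinom q n k · (G k · P (a · y) (n ∸ k)))
    ≈⟨ sumTo-cong n (λ k _ → *-congˡ (reassoc _ _ _ _)) ⟩
  sumTo n (λ k → qbinom q n k · (pow u (k C 2) · (A k · (pow y k · P (a · y) (n ∸ k)))))
    ∎
  where
  open CommutativeRing R renaming (_*_ to _·_)
  open QDefs R
  open Ring R
  open QExponential q
  open import Relation.Binary.Reasoning.Setoid setoid

  P : Carrier → ℕ → Carrier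
  P = Pcoef q u aα x
  E : Carrier → ℕ → Carrier
  E = expCoeff u
  G : ℕ → Carrier
  G k = pow u (k C 2) · (A k · pow y k)

  E-split : ∀ k → E y k ≈ (G ⊛ E (a · y)) k
  E-split k = sym (trans (⊛-comm G (E (a · y)) k) (expCoeff-factorisation uu⁻¹ a y A recursion k))

  reassoc : ∀ w b z p → w · (b · z) · p ≈ w · (b · (z · p))
  reassoc w b z p = trans (*-assoc w (b · z) p) (*-congˡ (*-assoc b z p))
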